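{- For the two-process equality negation task and any $N\ge0$, let $X$ be a facet of $\mathcal{I}[\mathcal{MP}_N]$ and let $Y$ be a facet of $\mathcal{O}$ such that $\pi(X)=\pi(Y)$. Then for every positive formula $\phi$: if $\mathcal{O},Y\models\phi$ then $\mathcal{I}[\mathcal{MP}_N],X\models\phi$.
   Context: Simplicial models. Agents $\mathrm{Ag}=\{B,W\}$. A simplicial model $\langle C,\chi,\ell\rangle$ is a pure chromatic simplicial complex of dimension 1 (non-empty finite vertex sets closed under non-empty subsets, vertices colored by agents injectively on each simplex) with a labeling $\ell$ of each vertex $v$ by a set of atomic propositions concerning agent $\chi(v)$; facets (maximal simplices) are worlds; $\ell(X)=\bigcup_{v\in X}\ell(v)$. Formulas: $\phi::=p\mid\neg\phi\mid\phi\wedge\phi\mid K_a\phi$; $\mathcal{M},X\models p$ iff $p\in\ell(X)$; Booleans as usual; $\mathcal{M},X\models K_a\phi$ iff $\phi$ holds at every facet $Y$ with $a\in\chi(X\cap Y)$. A positive formula is one containing no negation except possibly directly in front of atomic propositions. Action models and product update. An action model $\langle T,\sim,\mathsf{pre}\rangle$: set $T$, equivalence relations $\sim_a$, preconditions $\mathsf{pre}(t)$. The product update $\mathcal{M}[\mathcal{A}]$ has vertices $(v,E)$, $v$ a vertex, $E$ a $\sim_{\chi(v)}$-class, such that some facet $X\ni v$ and $t\in E$ satisfy $\mathcal{M},X\models\mathsf{pre}(t)$; its facets are $\{(v,[t]_{\chi(v)}):v\in X\}$ for facets $X$ and actions $t$ with $\mathcal{M},X\models\mathsf{pre}(t)$;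 $(v,E)$ inherits the color and labeling of $v$; the projection is $\pi(v,E)=v$ (applied elementwise to facets). Equality negation. Atoms $\mathrm{in}_p^i$ ($p\in\mathrm{Ag}$, $i\in\{0,1,2\}$). Input model $\mathcal{I}$: vertices $(p,i)$, facets all $\{(B,i),(W,j)\}$, color $p$, label $\{\mathrm{in}_p^i\}$. Output model $\mathcal{O}$: vertices $(p,i,d)$ with $d\in\{0,1\}$, facets $\{(B,i,d_B),(W,j,d_W)\}$ with $i=j\iff d_B\neq d_W$, color $p$, label $\{\mathrm{in}_p^i\}$, projection $\pi(p,i,d)=(p,i)$. $N$-layer message-passing action model $\mathcal{MP}_N$: $L_N$ is the set of words of length $N$ over $\{\bot,B,W\}$; actions $T=L_N\times\mathcal{F}(\mathcal{I})$; $\mathsf{pre}(\alpha,X)=\bigwedge_{a}\mathrm{in}_a^{X_a}$ with $X_a$ the input of $a$ in $X$; for $N=0$, $(\varepsilon,X)\sim_a(\varepsilon,Y)$ iff $X_a=Y_a$; inductively $(\alpha p,X)\sim_B(\beta q,Y)$ iff either $p=q=W$ and $(\alpha,X)\sim_B(\beta,Y)$, or $p,q\in\{\bot,B\}$, $X=Y$ and $\alpha=\beta$; $\sim_W$ symmetrically with $B,W$ exchanged. -}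

module Defs where

open import Data.Nat using (ℕ; zero; suc)
open import Data.Fin using (Fin)
open import Data.Bool using (Bool)
open import Data.Product using (Σ; _×_; _,_)
open import Data.Sum using (_⊎_)
open import Data.Empty using (⊥)
open import Relation.Nullary using (¬_)
open import Relation.Binary.PropositionalEquality using (_≡_; _≢_)
open import Function.Bundles using (_⇔_)

data Ag : Set where
  B W : Ag

other : Ag → Ag
other B = W
other W = B

-- atom  in_p^i  is  (p , i)
Atom : Set
Atom = Ag × Fin 3

data Formula : Set where
  atom : Atom → Formula
  ¬'_  : Formula → Formula
  _∧'_ : Formula → Formula → Formula
  K    : Ag → Formula → Formula

data Positive : Formula → Set where
  pos-atom : ∀ p → Positive (atom p)
  pos-neg  : ∀ p → Positive (¬' atom p)
  pos-∧    : ∀ {φ ψ} → Positive φ → Positive ψ → Positive (φ ∧' ψ)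
  pos-K    : ∀ {a φ} → Positive φ → Positive (K a φ)

-- Two-agent pure chromatic simplicial models of dimension 1, presented
-- by their facets.  Every facet has exactly one vertex of each colour;
-- Sh a X Y  means  a ∈ χ(X ∩ Y)  (X and Y share their a-coloured vertex),
-- and  lab X p  means  p ∈ ℓ(X).

record SModel : Set₁ where
  field
    Facet : Set
    Sh    : Ag → Facet → Facet → Set
    lab   : Facet → Atom → Set
open SModel public

_,_⊨_ : (M : SModel) → Facet M → Formula → Set
M , X ⊨ atom p   = lab M X p
M , X ⊨ (¬' φ)   = ¬ (M , X ⊨ φ)
M , X ⊨ (φ ∧' ψ) = (M , X ⊨ φ) × (M , X ⊨ ψ)
M , X ⊨ K a φ    = (Y : Facet M) → Sh M a X Y → M , Y ⊨ φ

record ActionModel : Set₁ where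
  field
    Act : Set
    _∼⟨_⟩_ : Act → Ag → Act → Set
    pre : Act → Formula
open ActionModel public

-- Facets of M[A] are the pairs (X , t) with M , X ⊨ pre t; the facet is
-- {(v , [t]_χ(v)) : v ∈ X}.
_[_] : SModel → ActionModel → SModel
M [ A ] = record
  { Facet = Σ (Facet M) λ X → Σ (Act A) λ t → M , X ⊨ pre A t
  ; Sh    = λ { a (X , t , _) (Y , u , _) → Sh M a X Y × (_∼⟨_⟩_ A t a u) }
  ; lab   = λ { (X , _ , _) p → lab M X p }
  }

πPU : {M : SModel} {A : ActionModel} → Facet (M [ A ]) → Facet M
πPU (X , _ , _) = X

Inp : Set
Inp = Fin 3 × Fin 3

inp : Inp → Ag → Fin 3
inp (i , j) B = i
inp (i , j) W = j

𝓘 : SModel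
𝓘 = record
  { Facet = Inp
  ; Sh    = λ a X Y → inp X a ≡ inp Y a
  ; lab   = λ { X (p , i) → inp X p ≡ i }
  }

record OFacet : Set where
  constructor ofacet
  field
    oin  : Inp
    dB   : Bool
    dW   : Bool
    cond : (inp oin B ≡ inp oin W) ⇔ (dB ≢ dW)
open OFacet public

odec : OFacet → Ag → Bool
odec Y B = dB Y
odec Y W = dW Y

𝓞 : SModel
𝓞 = record
  { Facet = OFacet
  ; Sh    = λ a X Y → (inp (oin X) a ≡ inp (oin Y) a) × (odec X a ≡ odec Y a)
  ; lab   = λ { X (p , i) → inp (oin X) p ≡ i }
  }

πO : OFacet → Inp
πO = oin

data Sym : Set where
  ⊥s : Sym
  ag : Ag → Sym

-- words of length N, built by appending on the right (α p)
data Word : ℕ → Set where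
  ε   : Word zero
  _▷_ : ∀ {n} → Word n → Sym → Word (suc n)

MPAct : ℕ → Set
MPAct N = Word N × Inp

MPrel : (N : ℕ) → Ag → MPAct N → MPAct N → Set
MPrel zero    a (ε , X) (ε , Y) = inp X a ≡ inp Y a
MPrel (suc N) a (α ▷ p , X) (β ▷ q , Y) =
    (p ≡ ag (other a) × q ≡ ag (other a) × MPrel N a (α , X) (β , Y))
  ⊎ (p ≢ ag (other a) × q ≢ ag (other a) × X ≡ Y × α ≡ β)

MPpre : Inp → Formula
MPpre X = atom (B , inp X B) ∧' atom (W , inp X W)

𝓜𝓟 : ℕ → ActionModel
𝓜𝓟 N = record
  { Act    = MPAct N
  ; _∼⟨_⟩_ = λ t a u → MPrel N a t u
  ; pre    = λ { (_ , X) → MPpre X }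
  }

module Submission where

open import Defs
open import Data.Nat using (ℕ)
open import Data.Bool using (Bool; not)
open import Data.Bool.Properties using (not-¬)
open import Data.Empty using (⊥-elim)
open import Data.Fin.Properties using (_≟_)
open import Data.Product using (Σ-syntax; _×_; _,_)
open import Function using (_∘_)
open import Function.Bundles using (_⇔_; mk⇔; Equivalence)
open import Relation.Binary.PropositionalEquality using (_≡_; refl; sym; trans; cong; subst)
open import Relation.Nullary using (yes; no)

-- Positive formulas only look at atoms, negated atoms and K-boxes, so they transfer
-- along any relation that preserves atoms and lifts every a-edge of the target back to
-- an a-edge of the source.  Relating output facets to protocol facets with the same
-- inputs gives such a relation: whatever input facet an a-neighbour of X carries, it
-- extends to an output facet in which a keeps the decision it has in Y.

record BackSimulation (M M′ : SModel) (R : Facet M → Facet M′ → Set) : Set where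
  field
    atoms : ∀ {X X′} → R X X′ → ∀ p → lab M X p ⇔ lab M′ X′ p
    back  : ∀ {X X′} a Y′ → R X X′ → Sh M′ a X′ Y′ →
            Σ[ Y ∈ Facet M ] Sh M a X Y × R Y Y′

module _ {M M′ : SModel} {R : Facet M → Facet M′ → Set}
         (sim : BackSimulation M M′ R) where
  open BackSimulation sim

  positive-transfer : ∀ {X X′} → R X X′ → ∀ {φ} → Positive φ →
                      M , X ⊨ φ → M′ , X′ ⊨ φ
  positive-transfer r (pos-atom p) X⊨p  = Equivalence.to (atoms r p) X⊨p
  positive-transfer r (pos-neg p)  X⊨¬p = X⊨¬p ∘ Equivalence.from (atoms r p)
  positive-transfer r (pos-∧ φ⁺ ψ⁺) (X⊨φ , X⊨ψ) =
    positive-transfer r φ⁺ X⊨φ , positive-transfer r ψ⁺ X⊨ψ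
  positive-transfer r (pos-K {a} φ⁺) X⊨Kφ Y′ a-edge
    with back a Y′ r a-edge
  ... | Y , Y-edge , r′ = positive-transfer r′ φ⁺ (X⊨Kφ Y Y-edge)

-- For equal inputs the other agent decides the opposite bit, otherwise the same bit.
output-with : (x : Inp) (a : Ag) (d : Bool) →
              Σ[ Y ∈ OFacet ] oin Y ≡ x × odec Y a ≡ d
output-with x a d with inp x B ≟ inp x W
output-with x B d | yes i≡j = ofacet x d (not d) (mk⇔ (λ _ → not-¬ refl) (λ _ → i≡j)) , refl , refl
output-with x W d | yes i≡j = ofacet x (not d) d (mk⇔ (λ _ → not-¬ refl ∘ sym) (λ _ → i≡j)) , refl , refl
output-with x B d | no  i≢j = ofacet x d d (mk⇔ (⊥-elim ∘ i≢j) (λ d≢d → ⊥-elim (d≢d refl))) , refl , refl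
output-with x W d | no  i≢j = ofacet x d d (mk⇔ (⊥-elim ∘ i≢j) (λ d≢d → ⊥-elim (d≢d refl))) , refl , refl

same-input : (N : ℕ) → OFacet → Facet (𝓘 [ 𝓜𝓟 N ]) → Set
same-input N Y X = πPU {𝓘} {𝓜𝓟 N} X ≡ πO Y

output-back-simulates-protocol : (N : ℕ) → BackSimulation 𝓞 (𝓘 [ 𝓜𝓟 N ]) (same-input N)
output-back-simulates-protocol N .BackSimulation.atoms {X′ = x , _} x≡y (c , i) =
  mk⇔ (subst (λ z → inp z c ≡ i) (sym x≡y)) (subst (λ z → inp z c ≡ i) x≡y)
output-back-simulates-protocol N .BackSimulation.back {Y} {x , _} a (x′ , _) x≡y (a-input , _)
  with output-with x′ a (odec Y a)
... | Y′ , y′≡x′ , same-decision =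
  Y′ , (trans (cong (λ z → inp z a) (sym x≡y))
              (trans a-input (cong (λ z → inp z a) (sym y′≡x′)))
       , sym same-decision)
     , sym y′≡x′

lemma4 : (N : ℕ) (X : Facet (𝓘 [ 𝓜𝓟 N ])) (Y : OFacet) →
         πPU {𝓘} {𝓜𝓟 N} X ≡ πO Y →
         (φ : Formula) → Positive φ →
         𝓞 , Y ⊨ φ → (𝓘 [ 𝓜𝓟 N ]) , X ⊨ φ
lemma4 N X Y πX≡πY φ φ⁺ =
  positive-transfer (output-back-simulates-protocol N) πX≡πY φ⁺
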